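{- For all $g\in V(\mathcal{G})$ and $h\in V(\mathcal{H})$, the polynomial $\prod_{(g',h')\in T_{gh}}(1-x_{g'h'})$ belongs to the Vizing ideal $I_{\text{viz}}$.
   Context: Let $\mathbb{K}\subseteq\mathbb{R}$ be a field. Fix positive integers $k_\mathcal{G}\le n_\mathcal{G}$ and $k_\mathcal{H}\le n_\mathcal{H}$. Let $V(\mathcal{G})=\{g_1,\dots,g_{n_\mathcal{G}}\}$ with $D_\mathcal{G}=\{g_1,\dots,g_{k_\mathcal{G}}\}$, and $V(\mathcal{H})=\{h_1,\dots,h_{n_\mathcal{H}}\}$ with $D_\mathcal{H}=\{h_1,\dots,h_{k_\mathcal{H}}\}$. Introduce an edge variable $e_{gg'}=e_{g'g}$ for every unordered pair of distinct $g,g'\in V(\mathcal{G})$, an edge variable $e_{hh'}=e_{h'h}$ for every unordered pair of distinct $h,h'\in V(\mathcal{H})$, and a vertex variable $x_{gh}$ for every $(g,h)\in V(\mathcal{G}\square\mathcal{H}):=V(\mathcal{G})\times V(\mathcal{H})$. Let $P$ be the polynomial ring over $\mathbb{K}$ in all these variables. The Vizing ideal $I_{\text{viz}}\subseteq P$ is the ideal generated by: $e_{gg'}(e_{gg'}-1)$ for all distinct $g,g'\in V(\mathcal{G})$; $\prod_{g'\in D_\mathcal{G}}(1-e_{gg'})$ for all $g\in V(\mathcal{G})\setminus D_\mathcal{G}$; $\prod_{g'\in V(\mathcal{G})\setminus S}\big(\sum_{g\in S}e_{gg'}\big)$ for all $S\subseteq V(\mathcal{G})$ with $|S|=k_\mathcal{G}-1$;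 the three analogous families for $\mathcal{H}$ (with $e_{hh'}$, $D_\mathcal{H}$, $k_\mathcal{H}$); and, for all $g\in V(\mathcal{G})$, $h\in V(\mathcal{H})$, the polynomials $x_{gh}(x_{gh}-1)$ and $(1-x_{gh})\prod_{g'\in V(\mathcal{G}),g'\ne g}(1-e_{gg'}x_{g'h})\prod_{h'\in V(\mathcal{H}),h'\neq h}(1-e_{hh'}x_{gh'})$. For $(g,h)\in V(\mathcal{G}\square\mathcal{H})$ let $T_{gh}=\{(g',h')\in V(\mathcal{G}\square\mathcal{H}) : g'=g \text{ or } h'=h\}$. -}

module Defs where

open import Level using (Level; _⊔_)
open import Algebra.Bundles using (CommutativeRing)
open import Data.Nat as ℕ using (ℕ; _∸_)
open import Data.Fin as Fin using (Fin; toℕ; _<_)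
open import Data.Fin.Properties using (<-cmp; _≟_)
open import Data.Fin.Subset using (Subset; _∈_; ∣_∣)
open import Data.Fin.Subset.Properties using (_∈?_)
open import Data.List using (List; []; _∷_; map; foldr; filter; allFin; cartesianProduct)
open import Data.Product using (_×_; _,_; ∃)
open import Relation.Binary.Definitions using (tri<; tri≈; tri>)
open import Relation.Binary.PropositionalEquality using (_≡_; _≢_)
open import Relation.Nullary using (¬_)
open import Relation.Nullary.Decidable using (¬?; _⊎-dec_)

record IsField {c ℓ : Level} (K : CommutativeRing c ℓ) : Set (c ⊔ ℓ) where
  open CommutativeRing K
  field
    0≉1 : ¬ (0# ≈ 1#)
    inverse : ∀ a → ¬ (a ≈ 0#) → ∃ λ b → (a * b) ≈ 1#

-- The polynomial ring K[V] over a commutative ring K in a set V of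
-- variables, presented as the free commutative K-algebra on V:
-- polynomial expressions modulo the congruence generated by the
-- commutative ring axioms and the requirement that constants form a
-- ring homomorphic image of K.

module PolyRing {c ℓ : Level} (K : CommutativeRing c ℓ) (V : Set) where
  open CommutativeRing K using (Carrier; _≈_; _+_; _*_; 0#; 1#)

  infixl 6 _⊕_
  infixl 7 _⊗_
  infix 4 _≋_

  data Poly : Set c where
    con : Carrier → Poly
    var : V → Poly
    _⊕_ : Poly → Poly → Poly
    _⊗_ : Poly → Poly → Poly
    ⊝_  : Poly → Poly

  data _≋_ : Poly → Poly → Set (c ⊔ ℓ) where
    ≋-refl  : ∀ {p} → p ≋ p
    ≋-sym   : ∀ {p q} → p ≋ q → q ≋ p
    ≋-trans : ∀ {p q r} → p ≋ q → q ≋ r → p ≋ r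
    ⊕-cong  : ∀ {p p′ q q′} → p ≋ p′ → q ≋ q′ → p ⊕ q ≋ p′ ⊕ q′
    ⊗-cong  : ∀ {p p′ q q′} → p ≋ p′ → q ≋ q′ → p ⊗ q ≋ p′ ⊗ q′
    ⊝-cong  : ∀ {p q} → p ≋ q → ⊝ p ≋ ⊝ q
    ⊕-assoc : ∀ p q r → (p ⊕ q) ⊕ r ≋ p ⊕ (q ⊕ r)
    ⊕-comm  : ∀ p q → p ⊕ q ≋ q ⊕ p
    ⊕-idˡ   : ∀ p → con 0# ⊕ p ≋ p
    ⊕-invˡ  : ∀ p → (⊝ p) ⊕ p ≋ con 0#
    ⊗-assoc : ∀ p q r → (p ⊗ q) ⊗ r ≋ p ⊗ (q ⊗ r)
    ⊗-comm  : ∀ p q → p ⊗ q ≋ q ⊗ p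
    ⊗-idˡ   : ∀ p → con 1# ⊗ p ≋ p
    distribˡ : ∀ p q r → p ⊗ (q ⊕ r) ≋ (p ⊗ q) ⊕ (p ⊗ r)
    con-cong : ∀ {a b} → a ≈ b → con a ≋ con b
    con-+   : ∀ a b → con (a + b) ≋ con a ⊕ con b
    con-*   : ∀ a b → con (a * b) ≋ con a ⊗ con b

  one : Poly
  one = con 1#

  _⊖_ : Poly → Poly → Poly
  p ⊖ q = p ⊕ (⊝ q)

  prod : List Poly → Poly
  prod = foldr _⊗_ one

  sum : List Poly → Poly
  sum = foldr _⊕_ (con 0#)

  data InIdeal {g : Level} (G : Poly → Set g) : Poly → Set (c ⊔ ℓ ⊔ g) where
    gen  : ∀ {p} → G p → InIdeal G p
    zero : InIdeal G (con 0#)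
    add  : ∀ {p q} → InIdeal G p → InIdeal G q → InIdeal G (p ⊕ q)
    mul  : ∀ r {p} → InIdeal G p → InIdeal G (r ⊗ p)
    resp : ∀ {p q} → p ≋ q → InIdeal G p → InIdeal G q

-- The Vizing ideal.  Vertices of 𝒢 are Fin nG (g_{i+1} ↔ i), with
-- D_𝒢 = { i | toℕ i < kG }; likewise for ℋ.

module Vizing {c ℓ : Level} (K : CommutativeRing c ℓ) (nG kG nH kH : ℕ) where

  -- variables: one edge variable per unordered pair {i,j} (stored with i < j)
  -- and one vertex variable per vertex of 𝒢 □ ℋ
  data Var : Set where
    eG : (i j : Fin nG) → i < j → Var
    eH : (i j : Fin nH) → i < j → Var
    x  : Fin nG → Fin nH → Var

  open PolyRing K Var public

  -- e_{gg'} = e_{g'g} for distinct g, g' (the value for g = g' is never used)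
  eg : Fin nG → Fin nG → Poly
  eg i j with <-cmp i j
  ... | tri< i<j _ _ = var (eG i j i<j)
  ... | tri≈ _ _ _   = con (CommutativeRing.0# K)
  ... | tri> _ _ j<i = var (eG j i j<i)

  eh : Fin nH → Fin nH → Poly
  eh i j with <-cmp i j
  ... | tri< i<j _ _ = var (eH i j i<j)
  ... | tri≈ _ _ _   = con (CommutativeRing.0# K)
  ... | tri> _ _ j<i = var (eH j i j<i)

  xv : Fin nG → Fin nH → Poly
  xv g h = var (x g h)

  DG : List (Fin nG)
  DG = filter (λ i → toℕ i ℕ.<? kG) (allFin nG)

  DH : List (Fin nH)
  DH = filter (λ i → toℕ i ℕ.<? kH) (allFin nH)

  othersG : Fin nG → List (Fin nG)
  othersG g = filter (λ g′ → ¬? (g′ ≟ g)) (allFin nG)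

  othersH : Fin nH → List (Fin nH)
  othersH h = filter (λ h′ → ¬? (h′ ≟ h)) (allFin nH)

  inG : Subset nG → List (Fin nG)
  inG S = filter (λ i → i ∈? S) (allFin nG)

  outG : Subset nG → List (Fin nG)
  outG S = filter (λ i → ¬? (i ∈? S)) (allFin nG)

  inH : Subset nH → List (Fin nH)
  inH S = filter (λ i → i ∈? S) (allFin nH)

  outH : Subset nH → List (Fin nH)
  outH S = filter (λ i → ¬? (i ∈? S)) (allFin nH)

  data VizGen : Poly → Set c where
    edgeG : (g g′ : Fin nG) → g ≢ g′ → VizGen (eg g g′ ⊗ (eg g g′ ⊖ one))
    domG  : (g : Fin nG) → ¬ (toℕ g ℕ.< kG) →
            VizGen (prod (map (λ g′ → one ⊖ eg g g′) DG))
    sepG  : (S : Subset nG) → ∣ S ∣ ≡ kG ∸ 1 →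
            VizGen (prod (map (λ g′ → sum (map (λ g → eg g g′) (inG S))) (outG S)))
    edgeH : (h h′ : Fin nH) → h ≢ h′ → VizGen (eh h h′ ⊗ (eh h h′ ⊖ one))
    domH  : (h : Fin nH) → ¬ (toℕ h ℕ.< kH) →
            VizGen (prod (map (λ h′ → one ⊖ eh h h′) DH))
    sepH  : (S : Subset nH) → ∣ S ∣ ≡ kH ∸ 1 →
            VizGen (prod (map (λ h′ → sum (map (λ h → eh h h′) (inH S))) (outH S)))
    vertX : (g : Fin nG) (h : Fin nH) → VizGen (xv g h ⊗ (xv g h ⊖ one))
    closX : (g : Fin nG) (h : Fin nH) →
            VizGen ((one ⊖ xv g h)
                    ⊗ prod (map (λ g′ → one ⊖ (eg g g′ ⊗ xv g′ h)) (othersG g))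
                    ⊗ prod (map (λ h′ → one ⊖ (eh h h′ ⊗ xv g h′)) (othersH h)))

  InViz : Poly → Set (c ⊔ ℓ)
  InViz = InIdeal VizGen

  T : Fin nG → Fin nH → List (Fin nG × Fin nH)
  T g h = filter (λ { (g′ , h′) → (g′ ≟ g) ⊎-dec (h′ ≟ h) })
                 (cartesianProduct (allFin nG) (allFin nH))

  prodT : Fin nG → Fin nH → Poly
  prodT g h = prod (map (λ { (g′ , h′) → one ⊖ xv g′ h′ }) (T g h))

-- If a(a - 1) lies in an ideal I, then (1 - a)(1 - b a) ≡ 1 - a modulo I for every b,
-- so a multiple M of 1 - a satisfies M (1 - b a) ≡ M.  The product over T_{gh} is a
-- multiple of every 1 - x_{g′h} and every 1 - x_{gh′}, hence modulo I_viz it may be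
-- multiplied by all the factors 1 - e_{gg′} x_{g′h} and 1 - e_{hh′} x_{gh′} without
-- changing it; the result is a multiple of the generator closing (g, h), so it lies
-- in I_viz, and so does the product itself.
module Submission where

open import Defs
open import Level using (Level; _⊔_)
open import Algebra.Bundles using (CommutativeRing)
import Algebra.Properties.AbelianGroup as AbelianGroupProperties
import Algebra.Properties.CommutativeSemigroup as CommutativeSemigroupProperties
import Algebra.Properties.CommutativeSemigroup.Divisibility as Divisibility
import Algebra.Properties.Ring as RingProperties
open import Data.Nat using (ℕ; _≤_)
open import Data.Fin using (Fin)
open import Data.List using ([]; _∷_; map)
open import Data.List.Membership.Propositional using (_∈_)
open import Data.List.Membership.Propositional.Properties
  using (∈-filter⁺; ∈-cartesianProduct⁺; ∈-allFin)
open import Data.List.Relation.Unary.Any using (here; there)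
open import Data.Product using (∃; _×_; _,_)
open import Data.Sum using (inj₁; inj₂)
open import Relation.Binary.PropositionalEquality using (refl)
import Relation.Binary.Reasoning.Setoid as SetoidReasoning

module _ {c ℓ : Level} (R : CommutativeRing c ℓ) where
  open CommutativeRing R
  open RingProperties ring using (x[y-z]≈xy-xz; -‿distribˡ-*)
  open AbelianGroupProperties +-abelianGroup using (⁻¹-anti-homo‿-)
  open CommutativeSemigroupProperties *-commutativeSemigroup using (x∙yz≈y∙zx)
  open SetoidReasoning setoid

  [1-x][1-yx]≈[1-x]+y[x[x-1]] : ∀ x y → (1# - x) * (1# - y * x) ≈ (1# - x) + y * (x * (x - 1#))
  [1-x][1-yx]≈[1-x]+y[x[x-1]] x y = begin
    (1# - x) * (1# - y * x)             ≈⟨ x[y-z]≈xy-xz (1# - x) 1# (y * x) ⟩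
    (1# - x) * 1# - (1# - x) * (y * x)  ≈⟨ +-cong (*-identityʳ (1# - x)) (-‿distribˡ-* (1# - x) (y * x)) ⟩
    (1# - x) + - (1# - x) * (y * x)     ≈⟨ +-congˡ (*-congʳ (⁻¹-anti-homo‿- 1# x)) ⟩
    (1# - x) + (x - 1#) * (y * x)       ≈⟨ +-congˡ (x∙yz≈y∙zx (x - 1#) y x) ⟩
    (1# - x) + y * (x * (x - 1#))       ∎

module PolyRingProperties {c ℓ : Level} (K : CommutativeRing c ℓ) (V : Set) where
  open PolyRing K V

  polyRing : CommutativeRing c (c ⊔ ℓ)
  polyRing = record
    { Carrier = Poly ; _≈_ = _≋_ ; _+_ = _⊕_ ; _*_ = _⊗_ ; -_ = ⊝_
    ; 0# = con (CommutativeRing.0# K) ; 1# = one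
    ; isCommutativeRing = record
      { isRing = record
        { +-isAbelianGroup = record
          { isGroup = record
            { isMonoid = record
              { isSemigroup = record
                { isMagma = record
                  { isEquivalence = record { refl = ≋-refl ; sym = ≋-sym ; trans = ≋-trans }
                  ; ∙-cong = ⊕-cong }
                ; assoc = ⊕-assoc }
              ; identity = ⊕-idˡ , λ p → ≋-trans (⊕-comm p _) (⊕-idˡ p) }
            ; inverse = ⊕-invˡ , λ p → ≋-trans (⊕-comm p _) (⊕-invˡ p)
            ; ⁻¹-cong = ⊝-cong }
          ; comm = ⊕-comm }
        ; *-cong = ⊗-cong
        ; *-assoc = ⊗-assoc
        ; *-identity = ⊗-idˡ , λ p → ≋-trans (⊗-comm p _) (⊗-idˡ p)
        ; distrib = distribˡ , λ p q r → ≋-trans (⊗-comm (q ⊕ r) p)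
                      (≋-trans (distribˡ p q r) (⊕-cong (⊗-comm p q) (⊗-comm p r))) }
      ; *-comm = ⊗-comm } }

  open CommutativeRing polyRing hiding (zero; refl; distribˡ)
  open Divisibility *-commutativeSemigroup public using (_∣_; _,_; x∣xy; x∣ʳy⇒x∣ʳzy; x∣ʳy⇒xz∣ʳyz; ∣ʳ-trans)
  open CommutativeSemigroupProperties *-commutativeSemigroup using (x∙yz≈xz∙y)
  open SetoidReasoning setoid

  ∈⇒∣prod : ∀ {A : Set} (f : A → Poly) {t L} → t ∈ L → f t ∣ prod (map f L)
  ∈⇒∣prod f {L = _ ∷ L} (here refl) = x∣xy (f _) (prod (map f L))
  ∈⇒∣prod f {L = y ∷ _} (there t∈L) = x∣ʳy⇒x∣ʳzy (f y) (∈⇒∣prod f t∈L)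

  module Congruence {g : Level} (G : Poly → Set g) where

    infix 4 _≈ᴵ_

    _≈ᴵ_ : Poly → Poly → Set (c ⊔ ℓ ⊔ g)
    p ≈ᴵ q = ∃ λ r → InIdeal G r × p ≋ q + r

    InIdeal-∣ : ∀ {p q} → p ∣ q → InIdeal G p → InIdeal G q
    InIdeal-∣ (r , rp≈q) p∈I = resp rp≈q (mul r p∈I)

    InIdeal-neg : ∀ {p} → InIdeal G p → InIdeal G (- p)
    InIdeal-neg {p} p∈I = resp (-1*x≈-x p) (mul (- 1#) p∈I)
      where open RingProperties ring using (-1*x≈-x)

    ≈ᴵ-reflexive : ∀ {p q} → p ≋ q → p ≈ᴵ q
    ≈ᴵ-reflexive {q = q} p≈q = 0# , zero , trans p≈q (sym (+-identityʳ q))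

    ≈ᴵ-trans : ∀ {p q s} → p ≈ᴵ q → q ≈ᴵ s → p ≈ᴵ s
    ≈ᴵ-trans {p} {q} {s} (r , r∈I , p≈q+r) (r′ , r′∈I , q≈s+r′) = r′ + r , add r′∈I r∈I , (begin
      p             ≈⟨ p≈q+r ⟩
      q + r         ≈⟨ +-congʳ q≈s+r′ ⟩
      (s + r′) + r  ≈⟨ +-assoc s r′ r ⟩
      s + (r′ + r)  ∎)

    ≈ᴵ-*-congˡ : ∀ z {p q} → p ≈ᴵ q → z * p ≈ᴵ z * q
    ≈ᴵ-*-congˡ z {p} {q} (r , r∈I , p≈q+r) =
      z * r , mul z r∈I , trans (*-congˡ p≈q+r) (distribˡ z q r)

    InIdeal-resp-≈ᴵ : ∀ {p q} → p ≈ᴵ q → InIdeal G p → InIdeal G q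
    InIdeal-resp-≈ᴵ {p} {q} (r , r∈I , p≈q+r) p∈I = resp p-r≈q (add p∈I (InIdeal-neg r∈I))
      where
      p-r≈q : p - r ≋ q
      p-r≈q = begin
        p - r          ≈⟨ +-congʳ p≈q+r ⟩
        (q + r) - r    ≈⟨ +-assoc q r (- r) ⟩
        q + (r - r)    ≈⟨ +-congˡ (-‿inverseʳ r) ⟩
        q + 0#         ≈⟨ +-identityʳ q ⟩
        q              ∎

    1-x-absorbs : ∀ {a} b → InIdeal G (a * (a - 1#)) → (1# - a) * (1# - b * a) ≈ᴵ 1# - a
    1-x-absorbs {a} b idem = b * (a * (a - 1#)) , mul b idem , [1-x][1-yx]≈[1-x]+y[x[x-1]] polyRing a b

    ∣-absorbs : ∀ {a M} b → InIdeal G (a * (a - 1#)) → 1# - a ∣ M → M * (1# - b * a) ≈ᴵ M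
    ∣-absorbs {a} {M} b idem (Q , Q[1-a]≈M) = ≈ᴵ-trans (≈ᴵ-reflexive regroup)
      (≈ᴵ-trans (≈ᴵ-*-congˡ Q (1-x-absorbs b idem)) (≈ᴵ-reflexive Q[1-a]≈M))
      where
      regroup : M * (1# - b * a) ≋ Q * ((1# - a) * (1# - b * a))
      regroup = trans (*-congʳ (sym Q[1-a]≈M)) (*-assoc Q (1# - a) (1# - b * a))

    ∣-absorbs-prod : ∀ {A : Set} (a b : A → Poly) {M} → (∀ y → InIdeal G (a y * (a y - 1#))) →
                     (∀ y → 1# - a y ∣ M) → ∀ L → M * prod (map (λ y → 1# - b y * a y) L) ≈ᴵ M
    ∣-absorbs-prod a b {M} idem div [] = ≈ᴵ-reflexive (*-identityʳ M)
    ∣-absorbs-prod a b {M} idem div (y ∷ L) = ≈ᴵ-trans (≈ᴵ-reflexive (x∙yz≈xz∙y M _ P))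
      (≈ᴵ-trans (∣-absorbs (b y) (idem y) (∣ʳ-trans (div y) (x∣xy M P))) (∣-absorbs-prod a b idem div L))
      where P = prod (map (λ y → 1# - b y * a y) L)

lemma3p1 : ∀ {c ℓ : Level} (K : CommutativeRing c ℓ) → IsField K →
           (nG kG nH kH : ℕ) → 1 ≤ kG → kG ≤ nG → 1 ≤ kH → kH ≤ nH →
           (g : Fin nG) (h : Fin nH) →
           Vizing.InViz K nG kG nH kH (Vizing.prodT K nG kG nH kH g h)
lemma3p1 K _ nG kG nH kH _ _ _ _ g h =
  InIdeal-resp-≈ᴵ (≈ᴵ-trans absorb-H absorb-G) (InIdeal-∣ closX∣ (gen (closX g h)))
  where
  open Vizing K nG kG nH kH
  open PolyRingProperties K Var
  open Congruence VizGen

  PG PH : Poly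
  PG = prod (map (λ g′ → one ⊖ (eg g g′ ⊗ xv g′ h)) (othersG g))
  PH = prod (map (λ h′ → one ⊖ (eh h h′ ⊗ xv g h′)) (othersH h))

  1-x[g′h]∣prodT : ∀ g′ → one ⊖ xv g′ h ∣ prodT g h
  1-x[g′h]∣prodT g′ = ∈⇒∣prod _ (∈-filter⁺ _ (∈-cartesianProduct⁺ (∈-allFin g′) (∈-allFin h)) (inj₂ refl))

  1-x[gh′]∣prodT : ∀ h′ → one ⊖ xv g h′ ∣ prodT g h
  1-x[gh′]∣prodT h′ = ∈⇒∣prod _ (∈-filter⁺ _ (∈-cartesianProduct⁺ (∈-allFin g) (∈-allFin h′)) (inj₁ refl))

  absorb-G : prodT g h ⊗ PG ≈ᴵ prodT g h
  absorb-G = ∣-absorbs-prod (λ g′ → xv g′ h) (eg g) (λ g′ → gen (vertX g′ h)) 1-x[g′h]∣prodT (othersG g)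

  absorb-H : prodT g h ⊗ PG ⊗ PH ≈ᴵ prodT g h ⊗ PG
  absorb-H = ∣-absorbs-prod (λ h′ → xv g h′) (eh h) (λ h′ → gen (vertX g h′))
               (λ h′ → ∣ʳ-trans (1-x[gh′]∣prodT h′) (x∣xy (prodT g h) PG)) (othersH h)

  closX∣ : (one ⊖ xv g h) ⊗ PG ⊗ PH ∣ prodT g h ⊗ PG ⊗ PH
  closX∣ = x∣ʳy⇒xz∣ʳyz PH (x∣ʳy⇒xz∣ʳyz PG (1-x[g′h]∣prodT g))
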